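{- Let $p$ and $i$ be non-negative integers and let $(H_{m,n})_{0\leq m,n\leq p+i}$ and $(E_{m,n})_{0\leq m,n\leq p+i}$ be lower triangular matrices over a commutative ring, with $1$'s on the diagonal, which are inverse to each other. Let $(c_\ell)_{\ell\geq0}$ be a sequence of elements of the ring. Define, for $0\leq m,n\leq p+i$, $$H^+_{m,n}=\begin{cases}H_{m,n}+\sum_{q=0}^{p-n-1}c_q\,H_{m,2p-1-n-q}&\text{if } n<p,\\ H_{m,n}&\text{if } n\geq p,\end{cases}\qquad E^-_{m,n}=\begin{cases}E_{m,n}&\text{if } m<p,\\ E_{m,n}-\sum_{q=0}^{2p-1-m}c_q\,E_{2p-1-m-q,n}&\text{if } m\geq p,\end{cases}$$ where $H_{m,\ell}$ is understood to be $0$ whenever $\ell>p+i$ (an empty sum being $0$). Then $(H^+_{m,n})_{0\leq m,n\leq p+i}$ and $(E^-_{m,n})_{0\leq m,n\leq p+i}$ are lower triangular with $1$'s on the diagonal, and they are inverse to each other. -}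

module Defs where

open import Level using (Level)
open import Algebra.Bundles using (CommutativeRing)
open import Data.Nat using (ℕ; zero; suc; _∸_; _<_)
import Data.Nat as ℕ
open import Data.Nat.Properties using (_<?_)
open import Data.Fin using (Fin; toℕ; fromℕ<)
import Data.Fin as Fin
open import Data.Product using (_×_)
open import Relation.Nullary using (yes; no)

module Matrices {c ℓ : Level} (R : CommutativeRing c ℓ) where
  open CommutativeRing R

  Mat : ℕ → Set c
  Mat N = Fin N → Fin N → Carrier

  Σ< : ℕ → (ℕ → Carrier) → Carrier
  Σ< zero    f = 0#
  Σ< (suc k) f = Σ< k f + f k

  ΣFin : ∀ {N} → (Fin N → Carrier) → Carrier
  ΣFin {zero}  f = 0#
  ΣFin {suc N} f = f Fin.zero + ΣFin (λ j → f (Fin.suc j))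

  _⊗_ : ∀ {N} → Mat N → Mat N → Mat N
  (A ⊗ B) m n = ΣFin (λ k → A m k * B k n)

  δ : ∀ {N} → Fin N → Fin N → Carrier
  δ m n with toℕ m ℕ.≟ toℕ n
  ... | yes _ = 1#
  ... | no  _ = 0#

  IsUnitLowerTri : ∀ {N} → Mat N → Set ℓ
  IsUnitLowerTri A = (∀ m n → toℕ m < toℕ n → A m n ≈ 0#) × (∀ m → A m m ≈ 1#)

  AreInverse : ∀ {N} → Mat N → Mat N → Set ℓ
  AreInverse A B = (∀ m n → (A ⊗ B) m n ≈ δ m n) × (∀ m n → (B ⊗ A) m n ≈ δ m n)

  -- entry with natural-number indices, 0 outside the range
  at : ∀ {N} → Mat N → ℕ → ℕ → Carrier
  at {N} A m n with m <? N | n <? N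
  ... | yes m< | yes n< = A (fromℕ< m<) (fromℕ< n<)
  ... | _      | _      = 0#

  H⁺ : (p : ℕ) {N : ℕ} → (ℕ → Carrier) → Mat N → Mat N
  H⁺ p cs H m n with toℕ n <? p
  ... | yes _ = H m n + Σ< (p ∸ toℕ n) (λ q → cs q * at H (toℕ m) (2 ℕ.* p ∸ (1 ℕ.+ toℕ n ℕ.+ q)))
  ... | no  _ = H m n

  -- E⁻_{m,n} = E_{m,n} if m < p,  E_{m,n} - Σ_{q=0}^{2p-1-m} c_q E_{2p-1-m-q,n} otherwise
  -- (the number of summands is 2p - m, i.e. (2p ∸ m); empty when m ≥ 2p)
  E⁻ : (p : ℕ) {N : ℕ} → (ℕ → Carrier) → Mat N → Mat N
  E⁻ p cs E m n with toℕ m <? p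
  ... | yes _ = E m n
  ... | no  _ = E m n - Σ< (2 ℕ.* p ∸ toℕ m) (λ q → cs q * at E (2 ℕ.* p ∸ (1 ℕ.+ toℕ m ℕ.+ q)) (toℕ n))

-- Let U be the matrix with U k n = c (2p − 1 − n − k) if n < p ≤ k and n + k < 2p, and 0
-- otherwise. Unfolding the definitions, H⁺ = H (1 + U) and E⁻ = (1 − U) E: the q-th correction
-- term of H⁺ m n is the summand k = 2p − 1 − n − q of (H U) m n, and dually for E⁻. As U lives
-- in the block of columns < p and rows ≥ p, it is strictly lower triangular and U² = 0, so
-- 1 + U and 1 − U are unit lower triangular and inverse to each other. Hence so are
-- H (1 + U) and (1 − U) E.

module Submission where

open import Defs
open import Algebra.Bundles using (CommutativeRing)
open import Data.Nat using (ℕ; zero; suc; _∸_; _≤_; _<_)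
import Data.Nat as ℕ
open import Data.Nat.Properties
  using (_<?_; _≤?_; <⇒≤; <⇒≱; ≤-refl; ≤-<-trans; <-≤-trans; ≤∧≢⇒<; ≮⇒≥; m≤n+m; m<n⇒m<1+n; n<1+n; +-monoˡ-<)
import Data.Nat.Properties as ℕₚ
open import Data.Fin using (Fin; toℕ; opposite)
import Data.Fin as Fin
open import Data.Fin.Properties
  using (toℕ<n; toℕ-inject₁; toℕ-fromℕ; toℕ-injective; fromℕ<-toℕ; punchInᵢ≢i; opposite-prop; opposite-involutive; <⇒≢)
import Data.Fin.Permutation as Perm
open import Data.Product using (_×_; _,_)
open import Data.Sum using (_⊎_; inj₁; inj₂; [_,_])
open import Function using (_∘_; case_of_)
open import Relation.Nullary using (yes; no; ¬_)
open import Relation.Nullary.Decidable using (_×-dec_)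
open import Relation.Nullary.Negation using (contradiction)
open import Relation.Binary.PropositionalEquality as ≡ using (_≡_; _≢_)

module IndexArithmetic where

  open import Data.Nat
  open import Data.Nat.Properties
  open import Relation.Binary.PropositionalEquality

  2*m≡m+m : ∀ m → 2 * m ≡ m + m
  2*m≡m+m m = cong (m +_) (+-identityʳ m)

  2*m∸m≡m : ∀ m → 2 * m ∸ m ≡ m
  2*m∸m≡m m = trans (cong (_∸ m) (2*m≡m+m m)) (m+n∸m≡n m m)

  2*m∸n≡m∸n+m : ∀ {m n} → n ≤ m → 2 * m ∸ n ≡ m ∸ n + m
  2*m∸n≡m∸n+m {m} {n} n≤m = trans (cong (_∸ n) (2*m≡m+m m)) (+-∸-comm m n≤m)

  m∸[1+n+o]≡m∸n∸[1+o] : ∀ m n o → m ∸ suc (n + o) ≡ m ∸ n ∸ suc o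
  m∸[1+n+o]≡m∸n∸[1+o] m n o = trans (cong (m ∸_) (sym (+-suc n o))) (sym (∸-+-assoc m n (suc o)))

  m∸[1+o+n]≡m∸n∸[1+o] : ∀ m n o → m ∸ suc (o + n) ≡ m ∸ n ∸ suc o
  m∸[1+o+n]≡m∸n∸[1+o] m n o = trans (cong (λ k → m ∸ suc k) (+-comm o n)) (m∸[1+n+o]≡m∸n∸[1+o] m n o)

  [m+o]∸[n+o]≡m∸n : ∀ m n o → m + o ∸ (n + o) ≡ m ∸ n
  [m+o]∸[n+o]≡m∸n m n o = trans (cong₂ _∸_ (+-comm m o) (+-comm n o)) ([m+n]∸[m+o]≡n∸o o m n)

  m<o∸n⇒n+m<o : ∀ {m n o} → m < o ∸ n → n + m < o
  m<o∸n⇒n+m<o {m} {n} {o} m<o∸n = begin-strict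
    n + m        <⟨ +-monoʳ-< n m<o∸n ⟩
    n + (o ∸ n)  ≡⟨ m+[n∸m]≡n (<⇒≤ (m∸n≢0⇒n<m {o} {n} (m<n⇒n≢0 m<o∸n))) ⟩
    o            ∎
    where open ≤-Reasoning

  m∸n≤o⇒m≤n+o : ∀ {m n o} → m ∸ n ≤ o → m ≤ n + o
  m∸n≤o⇒m≤n+o {m} {n} m∸n≤o = ≤-trans (m≤n+m∸n m n) (+-monoʳ-≤ n m∸n≤o)

  m<2*n∸o⇒m<n : ∀ {m n o} → n ≤ o → m < 2 * n ∸ o → m < n
  m<2*n∸o⇒m<n {n = n} n≤o m<2n∸o =
    <-≤-trans m<2n∸o (≤-trans (∸-monoʳ-≤ (2 * n) n≤o) (≤-reflexive (2*m∸m≡m n)))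

  2*m∸[1+n+[o+m]]≡m∸n∸[1+o] : ∀ {m n} o → n ≤ m → 2 * m ∸ suc (n + (o + m)) ≡ m ∸ n ∸ suc o
  2*m∸[1+n+[o+m]]≡m∸n∸[1+o] {m} {n} o n≤m = begin
    2 * m ∸ suc (n + (o + m))  ≡⟨ m∸[1+n+o]≡m∸n∸[1+o] (2 * m) n (o + m) ⟩
    2 * m ∸ n ∸ suc (o + m)    ≡⟨ cong (_∸ suc (o + m)) (2*m∸n≡m∸n+m n≤m) ⟩
    m ∸ n + m ∸ (suc o + m)    ≡⟨ [m+o]∸[n+o]≡m∸n (m ∸ n) (suc o) m ⟩
    m ∸ n ∸ suc o              ∎
    where open ≡-Reasoning

  m∸n∸[1+o]+m≡2*m∸[1+n+o] : ∀ {m n o} → n ≤ m → o < m ∸ n → m ∸ n ∸ suc o + m ≡ 2 * m ∸ suc (n + o)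
  m∸n∸[1+o]+m≡2*m∸[1+n+o] {m} {n} {o} n≤m o<m∸n = begin
    m ∸ n ∸ suc o + m    ≡⟨ +-∸-comm m o<m∸n ⟨
    m ∸ n + m ∸ suc o    ≡⟨ cong (_∸ suc o) (2*m∸n≡m∸n+m n≤m) ⟨
    2 * m ∸ n ∸ suc o    ≡⟨ m∸[1+n+o]≡m∸n∸[1+o] (2 * m) n o ⟨
    2 * m ∸ suc (n + o)  ∎
    where open ≡-Reasoning

open IndexArithmetic

module MatrixAlgebra {c ℓ} (R : CommutativeRing c ℓ) where

  open CommutativeRing R
  open Matrices R
  open import Algebra.Properties.Semiring.Sum semiring
    using (sum; sum-cong-≋; sum-cong-≗; sum-replicate-zero; sum-remove; sum-init-last;
           ∑-comm; ∑-distrib-+; ∑-permute; *-distribˡ-sum; *-distribʳ-sum)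
  open import Algebra.Properties.Ring ring using (-1*x≈-x; -0#≈0#; -‿distribˡ-*; -‿distribʳ-*)
  open import Relation.Binary.Reasoning.Setoid setoid

  ΣFin≡sum : ∀ {N} (f : Fin N → Carrier) → ΣFin f ≡ sum f
  ΣFin≡sum {zero}  f = ≡.refl
  ΣFin≡sum {suc N} f = ≡.cong (f Fin.zero +_) (ΣFin≡sum (f ∘ Fin.suc))

  sum-zero : ∀ {N} {f : Fin N → Carrier} → (∀ k → f k ≈ 0#) → sum f ≈ 0#
  sum-zero {N} f≈0 = trans (sum-cong-≋ f≈0) (sum-replicate-zero N)

  sum-single : ∀ {N} (f : Fin N → Carrier) (m : Fin N) → (∀ k → k ≢ m → f k ≈ 0#) → sum f ≈ f m
  sum-single {suc N} f m f≈0 = begin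
    sum f                                  ≈⟨ sum-remove f ⟩
    f m + sum (λ k → f (Fin.punchIn m k))  ≈⟨ +-congˡ (sum-zero (λ k → f≈0 _ (punchInᵢ≢i m k))) ⟩
    f m + 0#                               ≈⟨ +-identityʳ (f m) ⟩
    f m                                    ∎

  sum-neg : ∀ {N} (f : Fin N → Carrier) → sum (λ k → - f k) ≈ - sum f
  sum-neg f = begin
    sum (λ k → - f k)       ≈⟨ sum-cong-≋ (λ k → sym (-1*x≈-x (f k))) ⟩
    sum (λ k → - 1# * f k)  ≈⟨ *-distribˡ-sum (- 1#) f ⟨
    - 1# * sum f            ≈⟨ -1*x≈-x (sum f) ⟩
    - sum f                 ∎

  Σ<≈sum : ∀ L (f : ℕ → Carrier) → Σ< L f ≈ sum (λ (k : Fin L) → f (toℕ k))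
  Σ<≈sum zero    f = refl
  Σ<≈sum (suc L) f = begin
    Σ< L f + f L                                     ≈⟨ +-congʳ (Σ<≈sum L f) ⟩
    sum (λ (k : Fin L) → f (toℕ k)) + f L            ≡⟨ ≡.cong₂ _+_ (sum-cong-≗ {L} (≡.cong f ∘ ≡.sym ∘ toℕ-inject₁))
                                                                    (≡.cong f (≡.sym (toℕ-fromℕ L))) ⟩
    sum (λ (k : Fin L) → f (toℕ (Fin.inject₁ k))) + f (toℕ (Fin.fromℕ L))
                                                     ≈⟨ sum-init-last (λ k → f (toℕ k)) ⟨
    sum (λ (k : Fin (suc L)) → f (toℕ k))            ∎

  Σ<-cong : ∀ L {f g : ℕ → Carrier} → (∀ q → q < L → f q ≈ g q) → Σ< L f ≈ Σ< L g
  Σ<-cong zero    f≈g = refl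
  Σ<-cong (suc L) f≈g = +-cong (Σ<-cong L (λ q q<L → f≈g q (m<n⇒m<1+n q<L))) (f≈g L (n<1+n L))

  Σ<-zero : ∀ L {f : ℕ → Carrier} → (∀ q → q < L → f q ≈ 0#) → Σ< L f ≈ 0#
  Σ<-zero L {f} f≈0 = trans (Σ<≈sum L f) (sum-zero (λ k → f≈0 (toℕ k) (toℕ<n k)))

  Σ<-+ : ∀ a b (f : ℕ → Carrier) → Σ< (b ℕ.+ a) f ≈ Σ< a f + Σ< b (λ j → f (j ℕ.+ a))
  Σ<-+ a zero    f = sym (+-identityʳ _)
  Σ<-+ a (suc b) f = trans (+-congʳ (Σ<-+ a b f)) (+-assoc _ _ _)

  Σ<-dropHead : ∀ a b {f : ℕ → Carrier} → (∀ k → k < a → f k ≈ 0#) →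
                Σ< (b ℕ.+ a) f ≈ Σ< b (λ j → f (j ℕ.+ a))
  Σ<-dropHead a b {f} f≈0 = trans (Σ<-+ a b f) (trans (+-congʳ (Σ<-zero a f≈0)) (+-identityˡ _))

  Σ<-dropTail : ∀ a b {f : ℕ → Carrier} → (∀ k → a ≤ k → f k ≈ 0#) → Σ< (b ℕ.+ a) f ≈ Σ< a f
  Σ<-dropTail a b {f} f≈0 = trans (Σ<-+ a b f)
    (trans (+-congˡ (Σ<-zero b (λ j _ → f≈0 (j ℕ.+ a) (m≤n+m a j)))) (+-identityʳ _))

  Σ<-support : ∀ a b {f : ℕ → Carrier} → (∀ k → a ≤ k → f k ≈ 0#) → (∀ k → b ≤ k → f k ≈ 0#) →
               Σ< a f ≈ Σ< b f
  Σ<-support a b {f} fa fb = begin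
    Σ< a f          ≈⟨ Σ<-dropTail a b fa ⟨
    Σ< (b ℕ.+ a) f  ≡⟨ ≡.cong (λ x → Σ< x f) (ℕₚ.+-comm b a) ⟩
    Σ< (a ℕ.+ b) f  ≈⟨ Σ<-dropTail b a fb ⟩
    Σ< b f          ∎

  Σ<-reverse : ∀ L (f : ℕ → ℕ → Carrier) → Σ< L (λ q → f q (L ∸ suc q)) ≈ Σ< L (λ q → f (L ∸ suc q) q)
  Σ<-reverse L f = begin
    Σ< L (λ q → f q (L ∸ suc q))
      ≈⟨ Σ<≈sum L _ ⟩
    sum (λ (k : Fin L) → f (toℕ k) (L ∸ suc (toℕ k)))
      ≡⟨ sum-cong-≗ (λ k → ≡.cong (f (toℕ k)) (≡.sym (opposite-prop {L} k))) ⟩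
    sum (λ (k : Fin L) → f (toℕ k) (toℕ (opposite k)))
      ≈⟨ ∑-permute (λ k → f (toℕ k) (toℕ (opposite k))) (Perm.reverse {L}) ⟩
    sum (λ (k : Fin L) → f (toℕ (opposite k)) (toℕ (opposite (opposite k))))
      ≡⟨ sum-cong-≗ (λ k → ≡.cong₂ f (opposite-prop {L} k) (≡.cong toℕ (opposite-involutive k))) ⟩
    sum (λ (k : Fin L) → f (L ∸ suc (toℕ k)) (toℕ k))
      ≈⟨ Σ<≈sum L _ ⟨
    Σ< L (λ q → f (L ∸ suc q) q)
      ∎

  infix 4 _≋_
  infixl 6 _⊕_
  infix 8 ⊝_

  _≋_ : ∀ {N} → Mat N → Mat N → Set ℓ
  A ≋ B = ∀ m n → A m n ≈ B m n

  ≋-refl : ∀ {N} {A : Mat N} → A ≋ A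
  ≋-refl m n = refl

  ≋-sym : ∀ {N} {A B : Mat N} → A ≋ B → B ≋ A
  ≋-sym A≋B m n = sym (A≋B m n)

  ≋-trans : ∀ {N} {A B C : Mat N} → A ≋ B → B ≋ C → A ≋ C
  ≋-trans A≋B B≋C m n = trans (A≋B m n) (B≋C m n)

  _⊕_ : ∀ {N} → Mat N → Mat N → Mat N
  (A ⊕ B) m n = A m n + B m n

  ⊝_ : ∀ {N} → Mat N → Mat N
  (⊝ A) m n = - A m n

  𝟎 : ∀ {N} → Mat N
  𝟎 _ _ = 0#

  ⊗≈sum : ∀ {N} (A B : Mat N) m n → (A ⊗ B) m n ≈ sum (λ k → A m k * B k n)
  ⊗≈sum A B m n = reflexive (ΣFin≡sum (λ k → A m k * B k n))

  ⊗-cong : ∀ {N} {A A′ B B′ : Mat N} → A ≋ A′ → B ≋ B′ → A ⊗ B ≋ A′ ⊗ B′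
  ⊗-cong {A = A} {A′} {B} {B′} A≋A′ B≋B′ m n = begin
    (A ⊗ B) m n                    ≈⟨ ⊗≈sum A B m n ⟩
    sum (λ k → A m k * B k n)      ≈⟨ sum-cong-≋ (λ k → *-cong (A≋A′ m k) (B≋B′ k n)) ⟩
    sum (λ k → A′ m k * B′ k n)    ≈⟨ ⊗≈sum A′ B′ m n ⟨
    (A′ ⊗ B′) m n                  ∎

  ⊗-assoc : ∀ {N} (A B C : Mat N) → (A ⊗ B) ⊗ C ≋ A ⊗ (B ⊗ C)
  ⊗-assoc A B C m n = begin
    ((A ⊗ B) ⊗ C) m n                                    ≈⟨ ⊗≈sum (A ⊗ B) C m n ⟩
    sum (λ k → (A ⊗ B) m k * C k n)                      ≈⟨ sum-cong-≋ (λ k → *-congʳ (⊗≈sum A B m k)) ⟩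
    sum (λ k → sum (λ j → A m j * B j k) * C k n)        ≈⟨ sum-cong-≋ (λ k → *-distribʳ-sum (C k n) (λ j → A m j * B j k)) ⟩
    sum (λ k → sum (λ j → (A m j * B j k) * C k n))      ≈⟨ ∑-comm (λ k j → (A m j * B j k) * C k n) ⟩
    sum (λ j → sum (λ k → (A m j * B j k) * C k n))      ≈⟨ sum-cong-≋ (λ j → sum-cong-≋ (λ k → *-assoc (A m j) (B j k) (C k n))) ⟩
    sum (λ j → sum (λ k → A m j * (B j k * C k n)))      ≈⟨ sum-cong-≋ (λ j → *-distribˡ-sum (A m j) (λ k → B j k * C k n)) ⟨
    sum (λ j → A m j * sum (λ k → B j k * C k n))        ≈⟨ sum-cong-≋ (λ j → *-congˡ (⊗≈sum B C j n)) ⟨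
    sum (λ j → A m j * (B ⊗ C) j n)                      ≈⟨ ⊗≈sum A (B ⊗ C) m n ⟨
    (A ⊗ (B ⊗ C)) m n                                    ∎

  δ-diag : ∀ {N} (m : Fin N) → δ m m ≈ 1#
  δ-diag m with toℕ m ℕ.≟ toℕ m
  ... | yes _   = refl
  ... | no  m≢m = contradiction ≡.refl m≢m

  δ-offdiag : ∀ {N} {m n : Fin N} → m ≢ n → δ m n ≈ 0#
  δ-offdiag {m = m} {n} m≢n with toℕ m ℕ.≟ toℕ n
  ... | yes m≡n = contradiction (toℕ-injective m≡n) m≢n
  ... | no  _   = refl

  ⊗-identityˡ : ∀ {N} (A : Mat N) → δ ⊗ A ≋ A
  ⊗-identityˡ A m n = begin
    (δ ⊗ A) m n                ≈⟨ ⊗≈sum δ A m n ⟩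
    sum (λ k → δ m k * A k n)  ≈⟨ sum-single _ m (λ k k≢m → trans (*-congʳ (δ-offdiag (k≢m ∘ ≡.sym))) (zeroˡ _)) ⟩
    δ m m * A m n              ≈⟨ trans (*-congʳ (δ-diag m)) (*-identityˡ _) ⟩
    A m n                      ∎

  ⊗-identityʳ : ∀ {N} (A : Mat N) → A ⊗ δ ≋ A
  ⊗-identityʳ A m n = begin
    (A ⊗ δ) m n                ≈⟨ ⊗≈sum A δ m n ⟩
    sum (λ k → A m k * δ k n)  ≈⟨ sum-single _ n (λ k k≢n → trans (*-congˡ (δ-offdiag k≢n)) (zeroʳ _)) ⟩
    A m n * δ n n              ≈⟨ trans (*-congˡ (δ-diag n)) (*-identityʳ _) ⟩
    A m n                      ∎

  ⊗-distribˡ-⊕ : ∀ {N} (A B C : Mat N) → A ⊗ (B ⊕ C) ≋ A ⊗ B ⊕ A ⊗ C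
  ⊗-distribˡ-⊕ A B C m n = begin
    (A ⊗ (B ⊕ C)) m n                                      ≈⟨ ⊗≈sum A (B ⊕ C) m n ⟩
    sum (λ k → A m k * (B k n + C k n))                    ≈⟨ sum-cong-≋ (λ k → distribˡ (A m k) _ _) ⟩
    sum (λ k → A m k * B k n + A m k * C k n)              ≈⟨ ∑-distrib-+ (λ k → A m k * B k n) (λ k → A m k * C k n) ⟩
    sum (λ k → A m k * B k n) + sum (λ k → A m k * C k n)  ≈⟨ +-cong (⊗≈sum A B m n) (⊗≈sum A C m n) ⟨
    (A ⊗ B ⊕ A ⊗ C) m n                                    ∎

  ⊗-distribʳ-⊕ : ∀ {N} (A B C : Mat N) → (A ⊕ B) ⊗ C ≋ A ⊗ C ⊕ B ⊗ C
  ⊗-distribʳ-⊕ A B C m n = begin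
    ((A ⊕ B) ⊗ C) m n                                      ≈⟨ ⊗≈sum (A ⊕ B) C m n ⟩
    sum (λ k → (A m k + B m k) * C k n)                    ≈⟨ sum-cong-≋ (λ k → distribʳ (C k n) _ _) ⟩
    sum (λ k → A m k * C k n + B m k * C k n)              ≈⟨ ∑-distrib-+ (λ k → A m k * C k n) (λ k → B m k * C k n) ⟩
    sum (λ k → A m k * C k n) + sum (λ k → B m k * C k n)  ≈⟨ +-cong (⊗≈sum A C m n) (⊗≈sum B C m n) ⟨
    (A ⊗ C ⊕ B ⊗ C) m n                                    ∎

  ⊗-negˡ : ∀ {N} (A B : Mat N) → (⊝ A) ⊗ B ≋ ⊝ (A ⊗ B)
  ⊗-negˡ A B m n = begin
    ((⊝ A) ⊗ B) m n                ≈⟨ ⊗≈sum (⊝ A) B m n ⟩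
    sum (λ k → - A m k * B k n)    ≈⟨ sum-cong-≋ (λ k → sym (-‿distribˡ-* (A m k) (B k n))) ⟩
    sum (λ k → - (A m k * B k n))  ≈⟨ sum-neg (λ k → A m k * B k n) ⟩
    - sum (λ k → A m k * B k n)    ≈⟨ -‿cong (⊗≈sum A B m n) ⟨
    (⊝ (A ⊗ B)) m n                ∎

  ⊗-negʳ : ∀ {N} (A B : Mat N) → A ⊗ (⊝ B) ≋ ⊝ (A ⊗ B)
  ⊗-negʳ A B m n = begin
    (A ⊗ (⊝ B)) m n                ≈⟨ ⊗≈sum A (⊝ B) m n ⟩
    sum (λ k → A m k * - B k n)    ≈⟨ sum-cong-≋ (λ k → sym (-‿distribʳ-* (A m k) (B k n))) ⟩
    sum (λ k → - (A m k * B k n))  ≈⟨ sum-neg (λ k → A m k * B k n) ⟩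
    - sum (λ k → A m k * B k n)    ≈⟨ -‿cong (⊗≈sum A B m n) ⟨
    (⊝ (A ⊗ B)) m n                ∎

  ⊗-cancel-middle : ∀ {N} (A B C D : Mat N) → B ⊗ C ≋ δ → (A ⊗ B) ⊗ (C ⊗ D) ≋ A ⊗ D
  ⊗-cancel-middle A B C D BC≋δ =
    ≋-trans (⊗-assoc A B (C ⊗ D))
   (≋-trans (⊗-cong ≋-refl (≋-sym (⊗-assoc B C D)))
   (≋-trans (⊗-cong ≋-refl (⊗-cong BC≋δ ≋-refl))
            (⊗-cong ≋-refl (⊗-identityˡ D))))

  δ⊕-⊗-δ⊕-expand : ∀ {N} (A B : Mat N) → (δ ⊕ A) ⊗ (δ ⊕ B) ≋ δ ⊕ ((A ⊕ B) ⊕ A ⊗ B)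
  δ⊕-⊗-δ⊕-expand A B m n = begin
    ((δ ⊕ A) ⊗ (δ ⊕ B)) m n                          ≈⟨ ⊗-distribˡ-⊕ (δ ⊕ A) δ B m n ⟩
    ((δ ⊕ A) ⊗ δ) m n + ((δ ⊕ A) ⊗ B) m n            ≈⟨ +-cong (⊗-identityʳ (δ ⊕ A) m n) (⊗-distribʳ-⊕ δ A B m n) ⟩
    (δ m n + A m n) + ((δ ⊗ B) m n + (A ⊗ B) m n)    ≈⟨ +-congˡ (+-congʳ (⊗-identityˡ B m n)) ⟩
    (δ m n + A m n) + (B m n + (A ⊗ B) m n)          ≈⟨ +-assoc _ _ _ ⟩
    δ m n + (A m n + (B m n + (A ⊗ B) m n))          ≈⟨ +-congˡ (+-assoc _ _ _) ⟨
    δ m n + ((A m n + B m n) + (A ⊗ B) m n)          ∎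

  δ⊕-⊗-δ⊕≋δ : ∀ {N} {A B : Mat N} → A ⊕ B ≋ 𝟎 → A ⊗ B ≋ 𝟎 → (δ ⊕ A) ⊗ (δ ⊕ B) ≋ δ
  δ⊕-⊗-δ⊕≋δ {A = A} {B} A+B≋𝟎 AB≋𝟎 m n = begin
    ((δ ⊕ A) ⊗ (δ ⊕ B)) m n                  ≈⟨ δ⊕-⊗-δ⊕-expand A B m n ⟩
    δ m n + ((A m n + B m n) + (A ⊗ B) m n)  ≈⟨ +-congˡ (+-cong (A+B≋𝟎 m n) (AB≋𝟎 m n)) ⟩
    δ m n + (0# + 0#)                        ≈⟨ +-congˡ (+-identityʳ 0#) ⟩
    δ m n + 0#                               ≈⟨ +-identityʳ (δ m n) ⟩
    δ m n                                    ∎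

  square-zero⇒δ⊕-areInverse : ∀ {N} (U : Mat N) → U ⊗ U ≋ 𝟎 → AreInverse (δ ⊕ U) (δ ⊕ ⊝ U)
  square-zero⇒δ⊕-areInverse U U²≋𝟎 =
      δ⊕-⊗-δ⊕≋δ (λ m n → -‿inverseʳ (U m n)) (≋-trans (⊗-negʳ U U) ⊝U²≋𝟎)
    , δ⊕-⊗-δ⊕≋δ (λ m n → -‿inverseˡ (U m n)) (≋-trans (⊗-negˡ U U) ⊝U²≋𝟎)
    where
    ⊝U²≋𝟎 : ⊝ (U ⊗ U) ≋ 𝟎
    ⊝U²≋𝟎 m n = trans (-‿cong (U²≋𝟎 m n)) -0#≈0#

  areInverse-resp : ∀ {N} {A A′ B B′ : Mat N} → A ≋ A′ → B ≋ B′ → AreInverse A B → AreInverse A′ B′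
  areInverse-resp A≋A′ B≋B′ (AB≋δ , BA≋δ) =
      ≋-trans (⊗-cong (≋-sym A≋A′) (≋-sym B≋B′)) AB≋δ
    , ≋-trans (⊗-cong (≋-sym B≋B′) (≋-sym A≋A′)) BA≋δ

  areInverse-⊗ : ∀ {N} {A B C D : Mat N} → AreInverse A B → AreInverse C D → AreInverse (A ⊗ C) (D ⊗ B)
  areInverse-⊗ {A = A} {B} {C} {D} (AB≋δ , BA≋δ) (CD≋δ , DC≋δ) =
      ≋-trans (⊗-cancel-middle A C D B CD≋δ) AB≋δ
    , ≋-trans (⊗-cancel-middle D B A C BA≋δ) DC≋δ

  IsStrictlyLowerTri : ∀ {N} → Mat N → Set ℓ
  IsStrictlyLowerTri A = ∀ m n → toℕ m ≤ toℕ n → A m n ≈ 0#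

  ⊝-isStrictlyLowerTri : ∀ {N} {A : Mat N} → IsStrictlyLowerTri A → IsStrictlyLowerTri (⊝ A)
  ⊝-isStrictlyLowerTri A₀ m n m≤n = trans (-‿cong (A₀ m n m≤n)) -0#≈0#

  δ⊕-isUnitLowerTri : ∀ {N} {A : Mat N} → IsStrictlyLowerTri A → IsUnitLowerTri (δ ⊕ A)
  δ⊕-isUnitLowerTri A₀ =
      (λ m n m<n → trans (+-cong (δ-offdiag (<⇒≢ m<n)) (A₀ m n (<⇒≤ m<n))) (+-identityʳ 0#))
    , (λ m → trans (+-cong (δ-diag m) (A₀ m m ≤-refl)) (+-identityʳ 1#))

  ⊗-isUnitLowerTri : ∀ {N} {A B : Mat N} → IsUnitLowerTri A → IsUnitLowerTri B → IsUnitLowerTri (A ⊗ B)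
  ⊗-isUnitLowerTri {A = A} {B} (A₀ , A₁) (B₀ , B₁) =
      (λ m n m<n → trans (⊗≈sum A B m n) (sum-zero (λ k → term≈0 m n k (λ k≤m → ≤-<-trans k≤m m<n))))
    , (λ m → begin
         (A ⊗ B) m m                ≈⟨ ⊗≈sum A B m m ⟩
         sum (λ k → A m k * B k m)  ≈⟨ sum-single _ m (λ k k≢m → term≈0 m m k (λ k≤m → ≤∧≢⇒< k≤m (k≢m ∘ toℕ-injective))) ⟩
         A m m * B m m              ≈⟨ *-cong (A₁ m) (B₁ m) ⟩
         1# * 1#                    ≈⟨ *-identityˡ 1# ⟩
         1#                         ∎)
    where
    term≈0 : ∀ m n k → (toℕ k ≤ toℕ m → toℕ k < toℕ n) → A m k * B k n ≈ 0#
    term≈0 m n k k<n with toℕ m <? toℕ k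
    ... | yes m<k = trans (*-congʳ (A₀ m k m<k)) (zeroˡ (B k n))
    ... | no  m≮k = trans (*-congˡ (B₀ k n (k<n (≮⇒≥ m≮k)))) (zeroʳ (A m k))

  isUnitLowerTri-resp : ∀ {N} {A B : Mat N} → A ≋ B → IsUnitLowerTri A → IsUnitLowerTri B
  isUnitLowerTri-resp A≋B (A₀ , A₁) =
    (λ m n m<n → trans (sym (A≋B m n)) (A₀ m n m<n)) , (λ m → trans (sym (A≋B m m)) (A₁ m))

  at-toℕ : ∀ {N} (A : Mat N) m n → at A (toℕ m) (toℕ n) ≡ A m n
  at-toℕ {N} A m n with toℕ m <? N | toℕ n <? N
  ... | yes m<N | yes n<N = ≡.cong₂ A (fromℕ<-toℕ m m<N) (fromℕ<-toℕ n n<N)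
  ... | no  m≮N | _       = contradiction (toℕ<n m) m≮N
  ... | yes _   | no  n≮N = contradiction (toℕ<n n) n≮N

  at-outside : ∀ {N} (A : Mat N) m n → N ≤ m ⊎ N ≤ n → at A m n ≈ 0#
  at-outside {N} A m n outside with m <? N | n <? N
  ... | yes m<N | yes n<N = contradiction outside [ <⇒≱ m<N , <⇒≱ n<N ]
  ... | yes _   | no  _   = refl
  ... | no  _   | _       = refl

  module Shift (p : ℕ) (cs : ℕ → Carrier) where

    -- Without n + k < 2p the index 2p ∸ suc (n + k) would truncate to 0.
    u : ℕ → ℕ → Carrier
    u k n with n <? p ×-dec p ≤? k ×-dec n ℕ.+ k <? 2 ℕ.* p
    ... | yes _ = cs (2 ℕ.* p ∸ suc (n ℕ.+ k))
    ... | no  _ = 0#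

    U : ∀ {N} → Mat N
    U k n = u (toℕ k) (toℕ n)

    u-inside : ∀ {k n} → n < p → p ≤ k → n ℕ.+ k < 2 ℕ.* p → u k n ≈ cs (2 ℕ.* p ∸ suc (n ℕ.+ k))
    u-inside {k} {n} n<p p≤k n+k<2p with n <? p ×-dec p ≤? k ×-dec n ℕ.+ k <? 2 ℕ.* p
    ... | yes _      = refl
    ... | no  ¬range = contradiction (n<p , p≤k , n+k<2p) ¬range

    u-outside : ∀ {k n} → ¬ (n < p × p ≤ k × n ℕ.+ k < 2 ℕ.* p) → u k n ≈ 0#
    u-outside {k} {n} ¬range′ with n <? p ×-dec p ≤? k ×-dec n ℕ.+ k <? 2 ℕ.* p
    ... | yes range = contradiction range ¬range′
    ... | no  _     = refl

    U-isStrictlyLowerTri : ∀ {N} → IsStrictlyLowerTri (U {N})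
    U-isStrictlyLowerTri m n m≤n = u-outside (λ (n<p , p≤m , _) → <⇒≱ (<-≤-trans n<p p≤m) m≤n)

    U²≋𝟎 : ∀ {N} → U {N} ⊗ U ≋ 𝟎
    U²≋𝟎 m n = trans (⊗≈sum U U m n) (sum-zero term≈0)
      where
      term≈0 : ∀ k → U m k * U k n ≈ 0#
      term≈0 k = case toℕ k <? p of λ where
        (yes k<p) → trans (*-congˡ (u-outside (λ (_ , p≤k , _) → <⇒≱ k<p p≤k))) (zeroʳ _)
        (no  k≮p) → trans (*-congʳ (u-outside (λ (k<p , _) → k≮p k<p))) (zeroˡ _)

    column-sum : ∀ {N} (H : Mat N) m n → toℕ n < p →
                 sum (λ k → H m k * U k n)
                   ≈ Σ< (p ∸ toℕ n) (λ q → cs q * at H (toℕ m) (2 ℕ.* p ∸ (1 ℕ.+ toℕ n ℕ.+ q)))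
    column-sum {N} H m n n<p = begin
      sum (λ k → H m k * U k n)
        ≈⟨ sum-cong-≋ {N} (λ k → *-congʳ (reflexive (≡.sym (at-toℕ H m k)))) ⟩
      sum (λ (k : Fin N) → F (toℕ k))
        ≈⟨ Σ<≈sum N F ⟨
      Σ< N F
        ≈⟨ Σ<-support N (2 ℕ.* p ∸ n′) beyondN beyond2p∸n ⟩
      Σ< (2 ℕ.* p ∸ n′) F
        ≡⟨ ≡.cong (λ M → Σ< M F) (2*m∸n≡m∸n+m n≤p) ⟩
      Σ< (L ℕ.+ p) F
        ≈⟨ Σ<-dropHead p L belowP ⟩
      Σ< L (λ j → at H m′ (j ℕ.+ p) * u (j ℕ.+ p) n′)
        ≈⟨ Σ<-cong L (λ j j<L → trans (*-congˡ (u-col j<L)) (*-comm _ _)) ⟩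
      Σ< L (λ j → cs (L ∸ suc j) * at H m′ (j ℕ.+ p))
        ≈⟨ Σ<-reverse L (λ j q → cs q * at H m′ (j ℕ.+ p)) ⟩
      Σ< L (λ q → cs q * at H m′ (L ∸ suc q ℕ.+ p))
        ≈⟨ Σ<-cong L (λ q q<L → *-congˡ (reflexive (≡.cong (at H m′) (m∸n∸[1+o]+m≡2*m∸[1+n+o] n≤p q<L)))) ⟩
      Σ< L (λ q → cs q * at H m′ (2 ℕ.* p ∸ suc (n′ ℕ.+ q)))
        ∎
      where
      m′ n′ L : ℕ
      m′ = toℕ m
      n′ = toℕ n
      L = p ∸ n′
      n≤p : n′ ≤ p
      n≤p = <⇒≤ n<p
      F : ℕ → Carrier
      F k = at H m′ k * u k n′
      beyondN : ∀ k → N ≤ k → F k ≈ 0#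
      beyondN k N≤k = trans (*-congʳ (at-outside H m′ k (inj₂ N≤k))) (zeroˡ _)
      beyond2p∸n : ∀ k → 2 ℕ.* p ∸ n′ ≤ k → F k ≈ 0#
      beyond2p∸n k le = trans (*-congˡ (u-outside (λ (_ , _ , n+k<2p) → <⇒≱ n+k<2p (m∸n≤o⇒m≤n+o le)))) (zeroʳ _)
      belowP : ∀ k → k < p → F k ≈ 0#
      belowP k k<p = trans (*-congˡ (u-outside (λ (_ , p≤k , _) → <⇒≱ k<p p≤k))) (zeroʳ _)
      u-col : ∀ {j} → j < L → u (j ℕ.+ p) n′ ≈ cs (L ∸ suc j)
      u-col {j} j<L = trans
        (u-inside n<p (m≤n+m p j) (m<o∸n⇒n+m<o {n = n′} j+p<2p∸n))
        (reflexive (≡.cong cs (2*m∸[1+n+[o+m]]≡m∸n∸[1+o] j n≤p)))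
        where
        j+p<2p∸n : j ℕ.+ p < 2 ℕ.* p ∸ n′
        j+p<2p∸n = ≡.subst (j ℕ.+ p <_) (≡.sym (2*m∸n≡m∸n+m n≤p)) (+-monoˡ-< p j<L)

    row-sum : ∀ {N} (E : Mat N) m n → p ≤ toℕ m →
              sum (λ j → U m j * E j n)
                ≈ Σ< (2 ℕ.* p ∸ toℕ m) (λ q → cs q * at E (2 ℕ.* p ∸ (1 ℕ.+ toℕ m ℕ.+ q)) (toℕ n))
    row-sum {N} E m n p≤m = begin
      sum (λ j → U m j * E j n)
        ≈⟨ sum-cong-≋ {N} (λ j → *-congˡ (reflexive (≡.sym (at-toℕ E j n)))) ⟩
      sum (λ (j : Fin N) → G (toℕ j))
        ≈⟨ Σ<≈sum N G ⟨
      Σ< N G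
        ≈⟨ Σ<-support N L beyondN beyondL ⟩
      Σ< L G
        ≈⟨ Σ<-cong L (λ j j<L → *-congʳ (u-row j<L)) ⟩
      Σ< L (λ j → cs (L ∸ suc j) * at E j n′)
        ≈⟨ Σ<-reverse L (λ j q → cs q * at E j n′) ⟩
      Σ< L (λ q → cs q * at E (L ∸ suc q) n′)
        ≈⟨ Σ<-cong L (λ q _ → *-congˡ (reflexive (≡.cong (λ r → at E r n′) (≡.sym (m∸[1+n+o]≡m∸n∸[1+o] (2 ℕ.* p) m′ q))))) ⟩
      Σ< L (λ q → cs q * at E (2 ℕ.* p ∸ suc (m′ ℕ.+ q)) n′)
        ∎
      where
      m′ n′ L : ℕ
      m′ = toℕ m
      n′ = toℕ n
      L = 2 ℕ.* p ∸ m′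
      G : ℕ → Carrier
      G j = u m′ j * at E j n′
      beyondN : ∀ j → N ≤ j → G j ≈ 0#
      beyondN j N≤j = trans (*-congˡ (at-outside E j n′ (inj₁ N≤j))) (zeroʳ _)
      beyondL : ∀ j → L ≤ j → G j ≈ 0#
      beyondL j le = trans (*-congʳ (u-outside (λ (_ , _ , j+m<2p) →
        <⇒≱ j+m<2p (≡.subst (2 ℕ.* p ≤_) (ℕₚ.+-comm m′ j) (m∸n≤o⇒m≤n+o le))))) (zeroˡ _)
      u-row : ∀ {j} → j < L → u m′ j ≈ cs (L ∸ suc j)
      u-row {j} j<L = trans
        (u-inside (m<2*n∸o⇒m<n p≤m j<L) p≤m (≡.subst (ℕ._< 2 ℕ.* p) (ℕₚ.+-comm m′ j) (m<o∸n⇒n+m<o j<L)))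
        (reflexive (≡.cong cs (m∸[1+o+n]≡m∸n∸[1+o] (2 ℕ.* p) m′ j)))

    H⁺-col<p : ∀ {N} (H : Mat N) m n → toℕ n < p →
               H⁺ p cs H m n ≡ H m n + Σ< (p ∸ toℕ n) (λ q → cs q * at H (toℕ m) (2 ℕ.* p ∸ (1 ℕ.+ toℕ n ℕ.+ q)))
    H⁺-col<p H m n n<p with toℕ n <? p
    ... | yes _   = ≡.refl
    ... | no  n≮p = contradiction n<p n≮p

    H⁺-col≮p : ∀ {N} (H : Mat N) m n → ¬ toℕ n < p → H⁺ p cs H m n ≡ H m n
    H⁺-col≮p H m n n≮p with toℕ n <? p
    ... | yes n<p = contradiction n<p n≮p
    ... | no  _   = ≡.refl

    E⁻-row<p : ∀ {N} (E : Mat N) m n → toℕ m < p → E⁻ p cs E m n ≡ E m n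
    E⁻-row<p E m n m<p with toℕ m <? p
    ... | yes _   = ≡.refl
    ... | no  m≮p = contradiction m<p m≮p

    E⁻-row≮p : ∀ {N} (E : Mat N) m n → ¬ toℕ m < p →
               E⁻ p cs E m n ≡ E m n - Σ< (2 ℕ.* p ∸ toℕ m) (λ q → cs q * at E (2 ℕ.* p ∸ (1 ℕ.+ toℕ m ℕ.+ q)) (toℕ n))
    E⁻-row≮p E m n m≮p with toℕ m <? p
    ... | yes m<p = contradiction m<p m≮p
    ... | no  _   = ≡.refl

    H⁺≋H⊗[δ⊕U] : ∀ {N} (H : Mat N) → H⁺ p cs H ≋ H ⊗ (δ ⊕ U)
    H⁺≋H⊗[δ⊕U] H m n = begin
      H⁺ p cs H m n        ≈⟨ H⁺≈H+HU ⟩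
      H m n + (H ⊗ U) m n  ≈⟨ +-congʳ (⊗-identityʳ H m n) ⟨
      (H ⊗ δ ⊕ H ⊗ U) m n  ≈⟨ ⊗-distribˡ-⊕ H δ U m n ⟨
      (H ⊗ (δ ⊕ U)) m n    ∎
      where
      HU≈0 : ¬ toℕ n < p → (H ⊗ U) m n ≈ 0#
      HU≈0 n≮p = trans (⊗≈sum H U m n)
        (sum-zero (λ k → trans (*-congˡ (u-outside (λ (n<p , _) → n≮p n<p))) (zeroʳ (H m k))))

      H⁺≈H+HU : H⁺ p cs H m n ≈ H m n + (H ⊗ U) m n
      H⁺≈H+HU = case toℕ n <? p of λ where
        (yes n<p) → trans (reflexive (H⁺-col<p H m n n<p))
                      (+-congˡ (sym (trans (⊗≈sum H U m n) (column-sum H m n n<p))))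
        (no  n≮p) → trans (reflexive (H⁺-col≮p H m n n≮p))
                      (sym (trans (+-congˡ (HU≈0 n≮p)) (+-identityʳ (H m n))))

    E⁻≋[δ⊕⊝U]⊗E : ∀ {N} (E : Mat N) → E⁻ p cs E ≋ (δ ⊕ ⊝ U) ⊗ E
    E⁻≋[δ⊕⊝U]⊗E E m n = begin
      E⁻ p cs E m n            ≈⟨ E⁻≈E-UE ⟩
      E m n - (U ⊗ E) m n      ≈⟨ +-cong (⊗-identityˡ E m n) (⊗-negˡ U E m n) ⟨
      (δ ⊗ E ⊕ (⊝ U) ⊗ E) m n  ≈⟨ ⊗-distribʳ-⊕ δ (⊝ U) E m n ⟨
      ((δ ⊕ ⊝ U) ⊗ E) m n      ∎
      where
      UE≈0 : toℕ m < p → (U ⊗ E) m n ≈ 0#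
      UE≈0 m<p = trans (⊗≈sum U E m n)
        (sum-zero (λ j → trans (*-congʳ (u-outside (λ (_ , p≤m , _) → <⇒≱ m<p p≤m))) (zeroˡ (E j n))))

      E⁻≈E-UE : E⁻ p cs E m n ≈ E m n - (U ⊗ E) m n
      E⁻≈E-UE = case toℕ m <? p of λ where
        (yes m<p) → trans (reflexive (E⁻-row<p E m n m<p))
                      (sym (trans (+-congˡ (trans (-‿cong (UE≈0 m<p)) -0#≈0#)) (+-identityʳ (E m n))))
        (no  m≮p) → trans (reflexive (E⁻-row≮p E m n m≮p))
                      (+-congˡ (-‿cong (sym (trans (⊗≈sum U E m n) (row-sum E m n (≮⇒≥ m≮p))))))

open import Data.Nat using (_+_)

lemma1 : ∀ {c ℓ} (R : CommutativeRing c ℓ) (p i : ℕ)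
         (H E : Matrices.Mat R (suc (p + i)))
         (cs : ℕ → CommutativeRing.Carrier R) →
         Matrices.IsUnitLowerTri R H → Matrices.IsUnitLowerTri R E →
         Matrices.AreInverse R H E →
         Matrices.IsUnitLowerTri R (Matrices.H⁺ R p cs H)
         × Matrices.IsUnitLowerTri R (Matrices.E⁻ R p cs E)
         × Matrices.AreInverse R (Matrices.H⁺ R p cs H) (Matrices.E⁻ R p cs E)
lemma1 R p i H E cs H-unit E-unit H⇔E =
    isUnitLowerTri-resp (≋-sym H⁺≋) (⊗-isUnitLowerTri H-unit P-unit)
  , isUnitLowerTri-resp (≋-sym E⁻≋) (⊗-isUnitLowerTri Q-unit E-unit)
  , areInverse-resp (≋-sym H⁺≋) (≋-sym E⁻≋) (areInverse-⊗ {A = H} {E} {P} {Q} H⇔E P⇔Q)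
  where
  open Matrices R
  open MatrixAlgebra R
  open Shift p cs

  P Q : Mat (suc (p + i))
  P = δ ⊕ U
  Q = δ ⊕ ⊝ U

  H⁺≋ : H⁺ p cs H ≋ H ⊗ P
  H⁺≋ = H⁺≋H⊗[δ⊕U] H

  E⁻≋ : E⁻ p cs E ≋ Q ⊗ E
  E⁻≋ = E⁻≋[δ⊕⊝U]⊗E E

  P-unit : IsUnitLowerTri P
  P-unit = δ⊕-isUnitLowerTri U-isStrictlyLowerTri

  Q-unit : IsUnitLowerTri Q
  Q-unit = δ⊕-isUnitLowerTri (⊝-isStrictlyLowerTri U-isStrictlyLowerTri)

  P⇔Q : AreInverse P Q
  P⇔Q = square-zero⇒δ⊕-areInverse U U²≋𝟎
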